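{- Let $\Phi$ be a twin-invariant graph property that is not meagre. Then there is a graph $H$ with an edge $\{u,v\}$ such that for the implant $\Psi_\Phi$ of $\Phi$ into $(\{u\},\{v\})$, for every integer $k\ge 1$ we have $\Psi_\Phi(\mathbf{B}_{k,k})\neq\Psi_\Phi(\mathbf{I}_{k,k})$.
   Context: Graphs are finite simple; graph properties are isomorphism-invariant maps to $\{0,1\}$. False twins are vertices with identical neighbourhoods; blocks are the classes of this relation; the twin-free quotient $H\!\downarrow$ has one vertex per block, blocks adjacent iff $H$ has an edge between them. $H_1,H_2$ are twin-equivalent if $H_1\!\downarrow\cong H_2\!\downarrow$; $\Phi$ is twin-invariant if $\Phi(H_1)=\Phi(H_2)$ for all twin-equivalent $H_1,H_2$ each with at least two vertices. $\Phi$ is meagre if only finitely many $k$ exist for which $\Phi$ is not constant on $k$-vertex graphs. For non-empty disjoint sets of false twins $B_1,B_2$ of $H$ and a bipartite graph $\mathbf{G}=(V_1,V_2,E)$ with ordered bipartition, with $R=V(H)\setminus(B_1\cup B_2)$, the implant $F_{\mathbf{G}}$ has vertex set $V_1\cup V_2\cup R$ and edges: those of $H[R]$; those of $E$; all edges between $v$ and $V_1$ for each $v\in R$ adjacent in $H$ to $B_1$; all edges between $v$ and $V_2$ for each $v\in R$ adjacent to $B_2$. The implant of $\Phi$ is $\Psi_\Phi(\mathbf{G})=\Phi(F_{\mathbf{G}})$. $\mathbf{B}_{k,k}=(L,R',L\times R')$, $\mathbf{I}_{k,k}=(L,R',\emptyset)$ with $|L|=|R'|=k$. -}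

module Defs where

open import Data.Nat using (ℕ; zero; suc; _+_; _≤_)
open import Data.Nat.Base using (_<ᵇ_)
open import Data.Bool using (Bool; true; false; not; _∧_)
open import Data.Bool.Properties using () renaming (_≟_ to _≟B_)
open import Data.Fin using (Fin; toℕ; splitAt)
open import Data.List using (List; allFin; filterᵇ; length; lookup)
open import Data.Bool.ListAction using (all; any)
open import Data.List.Membership.Propositional using (_∈_; _∉_)
open import Data.Sum using (_⊎_; inj₁; inj₂)
open import Data.Product using (Σ; ∃; _×_; _,_)
open import Relation.Nullary using (¬_)
open import Relation.Nullary.Decidable using (⌊_⌋)
open import Relation.Binary.PropositionalEquality using (_≡_; _≢_; refl)

record Graph : Set where
  field
    n       : ℕ
    adj     : Fin n → Fin n → Bool
    sym     : ∀ i j → adj i j ≡ adj j i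
    irrefl  : ∀ i → adj i i ≡ false
open Graph public

record _≅_ (G H : Graph) : Set where
  field
    to      : Fin (n G) → Fin (n H)
    from    : Fin (n H) → Fin (n G)
    from-to : ∀ i → from (to i) ≡ i
    to-from : ∀ j → to (from j) ≡ j
    pres    : ∀ i j → adj H (to i) (to j) ≡ adj G i j

IsGraphProperty : (Graph → Bool) → Set
IsGraphProperty Φ = ∀ G H → G ≅ H → Φ G ≡ Φ H

twinᵇ : (G : Graph) → Fin (n G) → Fin (n G) → Bool
twinᵇ G i j = all (λ w → ⌊ adj G i w ≟B adj G j w ⌋) (allFin (n G))

isRep : (G : Graph) → Fin (n G) → Bool
isRep G i = not (any (λ j → (toℕ j <ᵇ toℕ i) ∧ twinᵇ G j i) (allFin (n G)))

reps : (G : Graph) → List (Fin (n G))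
reps G = filterᵇ (isRep G) (allFin (n G))

-- the twin-free quotient G↓: one vertex per block (its least element);
-- blocks adjacent iff there is an edge between them (equivalently between
-- their representatives, since twins have equal neighbourhoods)
_↓ : Graph → Graph
G ↓ = record
  { n      = length (reps G)
  ; adj    = λ a b → adj G (lookup (reps G) a) (lookup (reps G) b)
  ; sym    = λ a b → sym G (lookup (reps G) a) (lookup (reps G) b)
  ; irrefl = λ a → irrefl G (lookup (reps G) a)
  }

TwinEquivalent : Graph → Graph → Set
TwinEquivalent H₁ H₂ = (H₁ ↓) ≅ (H₂ ↓)

TwinInvariant : (Graph → Bool) → Set
TwinInvariant Φ = ∀ H₁ H₂ → 2 ≤ n H₁ → 2 ≤ n H₂ → TwinEquivalent H₁ H₂ → Φ H₁ ≡ Φ H₂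

NonConstantOn : (Graph → Bool) → ℕ → Set
NonConstantOn Φ k = Σ Graph λ G₁ → Σ Graph λ G₂ →
  n G₁ ≡ k × n G₂ ≡ k × Φ G₁ ≢ Φ G₂

Meagre : (Graph → Bool) → Set
Meagre Φ = Σ (List ℕ) λ L → ∀ k → NonConstantOn Φ k → k ∈ L

-- not meagre, stated positively: no finite list contains all such k,
-- witnessed by an explicit k outside any given list
NotMeagre : (Graph → Bool) → Set
NotMeagre Φ = ∀ (L : List ℕ) → ∃ λ k → k ∉ L × NonConstantOn Φ k

record Bip : Set where
  field
    a b  : ℕ
    E    : Fin a → Fin b → Bool
open Bip public

Bkk : ℕ → Bip
Bkk k = record { a = k ; b = k ; E = λ _ _ → true }

Ikk : ℕ → Bip
Ikk k = record { a = k ; b = k ; E = λ _ _ → false }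

module _ (H : Graph) (u v : Fin (n H)) where

  Rlist : List (Fin (n H))
  Rlist = filterᵇ (λ w → not ⌊ w Data.Fin.≟ u ⌋ ∧ not ⌊ w Data.Fin.≟ v ⌋) (allFin (n H))

  rsize : ℕ
  rsize = length Rlist

  rv : Fin rsize → Fin (n H)
  rv = lookup Rlist

  data Part (G : Bip) : Set where
    p₁ : Fin (a G) → Part G
    p₂ : Fin (b G) → Part G
    pR : Fin rsize → Part G

  padj : (G : Bip) → Part G → Part G → Bool
  padj G (p₁ i) (p₁ j) = false
  padj G (p₁ i) (p₂ j) = E G i j
  padj G (p₁ i) (pR r) = adj H (rv r) u
  padj G (p₂ i) (p₁ j) = E G j i
  padj G (p₂ i) (p₂ j) = false
  padj G (p₂ i) (pR r) = adj H (rv r) v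
  padj G (pR r) (p₁ j) = adj H (rv r) u
  padj G (pR r) (p₂ j) = adj H (rv r) v
  padj G (pR r) (pR s) = adj H (rv r) (rv s)

  padj-sym : (G : Bip) → ∀ p q → padj G p q ≡ padj G q p
  padj-sym G (p₁ i) (p₁ j) = refl
  padj-sym G (p₁ i) (p₂ j) = refl
  padj-sym G (p₁ i) (pR r) = refl
  padj-sym G (p₂ i) (p₁ j) = refl
  padj-sym G (p₂ i) (p₂ j) = refl
  padj-sym G (p₂ i) (pR r) = refl
  padj-sym G (pR r) (p₁ j) = refl
  padj-sym G (pR r) (p₂ j) = refl
  padj-sym G (pR r) (pR s) = sym H (rv r) (rv s)

  padj-irr : (G : Bip) → ∀ p → padj G p p ≡ false
  padj-irr G (p₁ i) = refl
  padj-irr G (p₂ i) = refl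
  padj-irr G (pR r) = irrefl H (rv r)

  -- vertex set Fin (a + (b + |R|)) ≅ V₁ ⊎ V₂ ⊎ R
  part : (G : Bip) → Fin (a G + (b G + rsize)) → Part G
  part G x with splitAt (a G) x
  ... | inj₁ i = p₁ i
  ... | inj₂ y with splitAt (b G) y
  ...   | inj₁ j = p₂ j
  ...   | inj₂ r = pR r

  implant : Bip → Graph
  implant G = record
    { n      = a G + (b G + rsize)
    ; adj    = λ x y → padj G (part G x) (part G y)
    ; sym    = λ x y → padj-sym G (part G x) (part G y)
    ; irrefl = λ x → padj-irr G (part G x)
    }

Ψ : (Graph → Bool) → (H : Graph) → (u v : Fin (n H)) → Bip → Bool
Ψ Φ H u v G = Φ (implant H u v G)

{-# OPTIONS --safe #-}
module Submission where

-- Φ is not meagre, so it separates two graphs G₁, G₂ on some N ≥ 2 vertices.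
-- Deleting the edges of G₁, and those of G₂, one at a time ends in the same empty
-- graph, so along one of the two deletion sequences Φ changes at a single step:
-- some H with an edge uv has Φ H ≠ Φ (H − uv).  The implant of B_{k,k} into
-- ({u},{v}) is a blow-up of H (u and v become k false twins each, every other
-- vertex stays), and the implant of I_{k,k} is the same blow-up of H − uv.  A
-- blow-up is twin-equivalent to the graph it blows up, so twin invariance gives
-- Ψ(B_{k,k}) = Φ H ≠ Φ (H − uv) = Ψ(I_{k,k}).

open import Defs
open import Data.Nat using (ℕ; zero; suc; _+_; _≤_; z≤n; s≤s)
open import Data.Nat.Properties using (<ᵇ⇒<; <⇒<ᵇ; m≤n+m; ≤-trans)
open import Data.Bool using (Bool; true; false; not; _∧_; T)
open import Data.Bool.Properties
  using (T?; T-≡; T-∧; T-not-≡; ¬-not; ∧-zeroʳ; ∧-identityʳ) renaming (_≟_ to _≟ᵇ_)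
open import Data.Fin using (Fin; zero; suc; _↑ˡ_; _↑ʳ_; _≟_; _<_)
open import Data.Fin.Properties using (<-cmp; splitAt-↑ˡ; splitAt-↑ʳ)
open import Data.Fin.Induction using (<-wellFounded)
open import Data.List using (List; []; _∷_; allFin; lookup; cartesianProduct)
open import Data.List.Membership.Propositional using (_∈_; _∉_; lose)
open import Data.List.Membership.Propositional.Properties
  using (∈-allFin; ∈-lookup; ∈-filter⁺; ∈-filter⁻; ∈-cartesianProduct⁺)
open import Data.List.Relation.Unary.All as All using ()
open import Data.List.Relation.Unary.All.Properties using (all⁺; all⁻)
open import Data.List.Relation.Unary.Any as Any using (here; there; satisfied)
open import Data.List.Relation.Unary.Any.Properties using (any⁺; any⁻; lookup-index)
open import Data.List.Relation.Unary.AllPairs using (_∷_)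
open import Data.List.Relation.Unary.Unique.Propositional using (Unique)
open import Data.List.Relation.Unary.Unique.Propositional.Properties using (allFin⁺; filter⁺)
open import Data.Product as Prod using (Σ; ∃; _×_; _,_; proj₁; proj₂)
open import Data.Sum as Sum using (_⊎_; inj₁; inj₂)
open import Data.Empty using (⊥-elim)
open import Function using (id; _∘_; case_of_; Equivalence; mk⇔)
open import Induction.WellFounded using (Acc; acc)
open import Relation.Binary.Definitions using (tri<; tri≈; tri>)
open import Relation.Nullary using (¬_; Dec; yes; no; does)
open import Relation.Nullary.Decidable
  using ( ⌊_⌋; _×-dec_; _⊎-dec_; toWitness; fromWitness; toWitnessFalse; fromWitnessFalse
        ; dec-true; dec-false; does-⇔)
open import Relation.Binary.PropositionalEquality as ≡
  using (_≡_; _≢_; refl; trans; cong; cong₂; subst; module ≡-Reasoning)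

open Equivalence using (to; from)

-- Twins, blow-ups and twin-free quotients

Twin : (G : Graph) → Fin (n G) → Fin (n G) → Set
Twin G i j = ∀ w → adj G i w ≡ adj G j w

module TwinProperties (G : Graph) where

  Twin-refl : ∀ {i} → Twin G i i
  Twin-refl _ = refl

  Twin-sym : ∀ {i j} → Twin G i j → Twin G j i
  Twin-sym t w = ≡.sym (t w)

  Twin-trans : ∀ {i j k} → Twin G i j → Twin G j k → Twin G i k
  Twin-trans t t′ w = trans (t w) (t′ w)

  Twin⇒adjʳ : ∀ {i j} → Twin G i j → ∀ w → adj G w i ≡ adj G w j
  Twin⇒adjʳ {i} {j} t w = trans (sym G w i) (trans (t w) (sym G j w))

-- G arises from H by replacing every vertex y by the non-empty set of pairwise
-- false twins collapse⁻¹ y.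
record Blowup (G H : Graph) : Set where
  field
    collapse      : Fin (n G) → Fin (n H)
    lift          : Fin (n H) → Fin (n G)
    collapse-adj  : ∀ x y → adj H (collapse x) (collapse y) ≡ adj G x y
    collapse-lift : ∀ y → collapse (lift y) ≡ y

  adj-lift-collapse : ∀ y x → adj G (lift y) x ≡ adj H y (collapse x)
  adj-lift-collapse y x = trans (≡.sym (collapse-adj (lift y) x))
                                (cong (λ z → adj H z (collapse x)) (collapse-lift y))

  adj-lift : ∀ y y′ → adj G (lift y) (lift y′) ≡ adj H y y′
  adj-lift y y′ = trans (adj-lift-collapse y (lift y′)) (cong (adj H y) (collapse-lift y′))

  Twin-lift⁺ : ∀ {y y′} → Twin H y y′ → Twin G (lift y) (lift y′)
  Twin-lift⁺ {y} {y′} t w =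
    trans (adj-lift-collapse y w) (trans (t (collapse w)) (≡.sym (adj-lift-collapse y′ w)))

  Twin-lift⁻ : ∀ {y y′} → Twin G (lift y) (lift y′) → Twin H y y′
  Twin-lift⁻ {y} {y′} t w = trans (≡.sym (adj-lift y w)) (trans (t (lift w)) (adj-lift y′ w))

  Twin-lift-collapse : ∀ x → Twin G x (lift (collapse x))
  Twin-lift-collapse x w = trans (≡.sym (collapse-adj x w)) (≡.sym (adj-lift-collapse (collapse x) w))

record TwinQuotient (Q G : Graph) : Set where
  field
    rep           : Fin (n Q) → Fin (n G)
    block         : Fin (n G) → Fin (n Q)
    rep-adj       : ∀ a b → adj G (rep a) (rep b) ≡ adj Q a b
    Twin-rep      : ∀ x → Twin G x (rep (block x))
    Twin-rep-inj  : ∀ {a b} → Twin G (rep a) (rep b) → a ≡ b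

module _ {Q₁ Q₂ G : Graph} (P₁ : TwinQuotient Q₁ G) (P₂ : TwinQuotient Q₂ G) where
  open TwinProperties G
  private
    module P₁ = TwinQuotient P₁
    module P₂ = TwinQuotient P₂

  block∘rep-inverse : ∀ a → P₁.block (P₂.rep (P₂.block (P₁.rep a))) ≡ a
  block∘rep-inverse a = P₁.Twin-rep-inj
    (Twin-trans (Twin-sym (P₁.Twin-rep (P₂.rep _))) (Twin-sym (P₂.Twin-rep (P₁.rep a))))

  block∘rep-adj : ∀ a b → adj Q₂ (P₂.block (P₁.rep a)) (P₂.block (P₁.rep b)) ≡ adj Q₁ a b
  block∘rep-adj a b = begin
    adj Q₂ (P₂.block x) (P₂.block y)               ≡⟨ ≡.sym (P₂.rep-adj _ _) ⟩
    adj G (P₂.rep (P₂.block x)) (P₂.rep (P₂.block y)) ≡⟨ ≡.sym (P₂.Twin-rep x _) ⟩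
    adj G x (P₂.rep (P₂.block y))                  ≡⟨ ≡.sym (Twin⇒adjʳ (P₂.Twin-rep y) x) ⟩
    adj G x y                                      ≡⟨ P₁.rep-adj a b ⟩
    adj Q₁ a b                                     ∎
    where
    open ≡-Reasoning
    x = P₁.rep a
    y = P₁.rep b

TwinQuotient-unique : ∀ {Q₁ Q₂ G} → TwinQuotient Q₁ G → TwinQuotient Q₂ G → Q₁ ≅ Q₂
TwinQuotient-unique P₁ P₂ = record
  { to      = TwinQuotient.block P₂ ∘ TwinQuotient.rep P₁
  ; from    = TwinQuotient.block P₁ ∘ TwinQuotient.rep P₂
  ; from-to = block∘rep-inverse P₁ P₂
  ; to-from = block∘rep-inverse P₂ P₁
  ; pres    = block∘rep-adj P₁ P₂
  }

TwinQuotient-blowup : ∀ {Q G H} → Blowup G H → TwinQuotient Q H → TwinQuotient Q G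
TwinQuotient-blowup {Q} {G} {H} B P = record
  { rep          = lift ∘ rep
  ; block        = block ∘ collapse
  ; rep-adj      = λ a b → trans (adj-lift (rep a) (rep b)) (rep-adj a b)
  ; Twin-rep     = λ x → Twin-trans (Twin-lift-collapse x) (Twin-lift⁺ (Twin-rep (collapse x)))
  ; Twin-rep-inj = Twin-rep-inj ∘ Twin-lift⁻
  }
  where
  open Blowup B
  open TwinQuotient P
  open TwinProperties G

Unique⇒lookup-injective : ∀ {A : Set} {xs : List A} → Unique xs →
                          ∀ i j → lookup xs i ≡ lookup xs j → i ≡ j
Unique⇒lookup-injective {xs = _ ∷ _} _            zero    zero    _ = refl
Unique⇒lookup-injective {xs = _ ∷ _} (x≢ ∷ _)     zero    (suc j) e =
  ⊥-elim (All.lookup x≢ (∈-lookup j) e)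
Unique⇒lookup-injective {xs = _ ∷ _} (x≢ ∷ _)     (suc i) zero    e =
  ⊥-elim (All.lookup x≢ (∈-lookup i) (≡.sym e))
Unique⇒lookup-injective {xs = _ ∷ _} (_ ∷ unique) (suc i) (suc j) e =
  cong suc (Unique⇒lookup-injective unique i j e)

module _ (G : Graph) where
  open TwinProperties G

  private
    agreeAt : Fin (n G) → Fin (n G) → Fin (n G) → Bool
    agreeAt i j w = ⌊ adj G i w ≟ᵇ adj G j w ⌋

  twinᵇ⇒Twin : ∀ {i j} → T (twinᵇ G i j) → Twin G i j
  twinᵇ⇒Twin {i} {j} t w = toWitness (All.lookup (all⁺ (agreeAt i j) (allFin (n G)) t) (∈-allFin w))

  Twin⇒twinᵇ : ∀ {i j} → Twin G i j → T (twinᵇ G i j)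
  Twin⇒twinᵇ {i} {j} t = all⁻ (agreeAt i j) {xs = allFin (n G)} (All.tabulate λ {w} _ → fromWitness (t w))

  smaller-Twin⇒¬isRep : ∀ {i j} → i < j → Twin G i j → ¬ T (isRep G j)
  smaller-Twin⇒¬isRep {i} i<j t isRep-j =
    subst T (to T-not-≡ isRep-j) (any⁺ _ (lose (∈-allFin i) (from T-∧ (<⇒<ᵇ i<j , Twin⇒twinᵇ t))))

  ¬isRep⇒smaller-Twin : ∀ {j} → ¬ T (isRep G j) → ∃ λ i → i < j × Twin G i j
  ¬isRep⇒smaller-Twin {j} ¬isRep-j
    with satisfied (any⁻ _ (allFin (n G)) (from T-≡ (¬-not (¬isRep-j ∘ from T-not-≡))))
  ... | i , i<j∧twin with to T-∧ i<j∧twin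
  ...   | i<j , twin = i , <ᵇ⇒< _ _ i<j , twinᵇ⇒Twin twin

  isRep-Twin : ∀ x → ∃ λ y → T (isRep G y) × Twin G y x
  isRep-Twin x = go x (<-wellFounded x)
    where
    go : ∀ x → Acc _<_ x → ∃ λ y → T (isRep G y) × Twin G y x
    go x (acc smaller) with T? (isRep G x)
    ... | yes isRep-x = x , isRep-x , Twin-refl
    ... | no ¬isRep-x with ¬isRep⇒smaller-Twin ¬isRep-x
    ...   | i , i<x , t with go i (smaller i<x)
    ...     | y , isRep-y , t′ = y , isRep-y , Twin-trans t′ t

  isRep-Twin-unique : ∀ {i j} → T (isRep G i) → T (isRep G j) → Twin G i j → i ≡ j
  isRep-Twin-unique {i} {j} isRep-i isRep-j t with <-cmp i j
  ... | tri< i<j _ _ = ⊥-elim (smaller-Twin⇒¬isRep i<j t isRep-j)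
  ... | tri≈ _ i≡j _ = i≡j
  ... | tri> _ _ j<i = ⊥-elim (smaller-Twin⇒¬isRep j<i (Twin-sym t) isRep-i)

  ↓-TwinQuotient : TwinQuotient (G ↓) G
  ↓-TwinQuotient = record
    { rep          = lookup (reps G)
    ; block        = Any.index ∘ rep∈reps
    ; rep-adj      = λ _ _ → refl
    ; Twin-rep     = λ x → subst (Twin G x) (lookup-index (rep∈reps x))
                               (Twin-sym (proj₂ (proj₂ (isRep-Twin x))))
    ; Twin-rep-inj = λ {a} {b} t → Unique⇒lookup-injective (filter⁺ _ (allFin⁺ (n G))) a b
                       (isRep-Twin-unique (isRep-lookup a) (isRep-lookup b) t)
    }
    where
    rep∈reps : ∀ x → proj₁ (isRep-Twin x) ∈ reps G
    rep∈reps x = ∈-filter⁺ (T? ∘ isRep G) (∈-allFin _) (proj₁ (proj₂ (isRep-Twin x)))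

    isRep-lookup : ∀ a → T (isRep G (lookup (reps G) a))
    isRep-lookup a = proj₂ (∈-filter⁻ (T? ∘ isRep G) {xs = allFin (n G)} (∈-lookup a))

blowup⇒TwinEquivalent : ∀ {G H} → Blowup G H → TwinEquivalent G H
blowup⇒TwinEquivalent {G} {H} B =
  TwinQuotient-unique (↓-TwinQuotient G) (TwinQuotient-blowup B (↓-TwinQuotient H))

-- Deleting edges

-- By record η every graph G is definitionally graph (adj G) (sym G) (irrefl G),
-- so lemmas about graph A … apply to arbitrary graphs.
graph : {N : ℕ} (A : Fin N → Fin N → Bool) →
        (∀ i j → A i j ≡ A j i) → (∀ i → A i i ≡ false) → Graph
graph {N} A A-sym A-irrefl = record { n = N ; adj = A ; sym = A-sym ; irrefl = A-irrefl }

≗⇒≅ : ∀ {N} {A B : Fin N → Fin N → Bool} {A-sym A-irrefl B-sym B-irrefl} →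
      (∀ i j → A i j ≡ B i j) → graph A A-sym A-irrefl ≅ graph B B-sym B-irrefl
≗⇒≅ A≗B = record
  { to = id ; from = id ; from-to = λ _ → refl ; to-from = λ _ → refl ; pres = λ i j → ≡.sym (A≗B i j) }

emptyGraph : ℕ → Graph
emptyGraph N = graph {N} (λ _ _ → false) (λ _ _ → refl) (λ _ → refl)

Joins : ∀ {N} → Fin N → Fin N → Fin N → Fin N → Set
Joins u v i j = (i ≡ u × j ≡ v) ⊎ (i ≡ v × j ≡ u)

Joins-sym : ∀ {N} {u v i j : Fin N} → Joins u v i j → Joins u v j i
Joins-sym = Sum.swap ∘ Sum.map Prod.swap Prod.swap

joins? : ∀ {N} (u v i j : Fin N) → Dec (Joins u v i j)
joins? u v i j = (i ≟ u ×-dec j ≟ v) ⊎-dec (i ≟ v ×-dec j ≟ u)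

joins?-sym : ∀ {N} (u v i j : Fin N) → does (joins? u v i j) ≡ does (joins? u v j i)
joins?-sym u v i j = does-⇔ (mk⇔ Joins-sym Joins-sym) (joins? u v i j) (joins? u v j i)

removeEdge : (G : Graph) → Fin (n G) → Fin (n G) → Graph
removeEdge G u v = graph (λ i j → adj G i j ∧ not (does (joins? u v i j)))
  (λ i j → cong₂ (λ x y → x ∧ not y) (sym G i j) (joins?-sym u v i j))
  (λ i → cong (λ x → x ∧ not (does (joins? u v i i))) (irrefl G i))

module _ (G : Graph) (u v : Fin (n G)) where

  removeEdge-removes : adj (removeEdge G u v) u v ≡ false
  removeEdge-removes = trans (cong (λ y → adj G u v ∧ not y) (dec-true (joins? u v u v) (inj₁ (refl , refl))))
                             (∧-zeroʳ _)

  removeEdge-⊆ : ∀ {i j} → adj (removeEdge G u v) i j ≡ true → adj G i j ≡ true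
  removeEdge-⊆ {i} {j} e with adj G i j
  ... | true  = refl
  ... | false = e

  removeEdge-away : ∀ {i j} → i ≢ u → i ≢ v → adj (removeEdge G u v) i j ≡ adj G i j
  removeEdge-away {i} {j} i≢u i≢v = trans (cong (λ y → adj G i j ∧ not y) (dec-false (joins? u v i j) uv≢ij))
                                          (∧-identityʳ _)
    where
    uv≢ij : ¬ Joins u v i j
    uv≢ij (inj₁ (i≡u , _)) = i≢u i≡u
    uv≢ij (inj₂ (i≡v , _)) = i≢v i≡v

  removeEdge-nonEdge : adj G u v ≡ false → removeEdge G u v ≅ G
  removeEdge-nonEdge nonEdge = ≗⇒≅ unchanged
    where
    unchanged : ∀ i j → adj G i j ∧ not (does (joins? u v i j)) ≡ adj G i j
    unchanged i j = unchanged′ (joins? u v i j)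
      where
      unchanged′ : (uv≟ij : Dec (Joins u v i j)) → adj G i j ∧ not (does uv≟ij) ≡ adj G i j
      unchanged′ (yes (inj₁ (refl , refl))) = trans (∧-zeroʳ _) (≡.sym nonEdge)
      unchanged′ (yes (inj₂ (refl , refl))) = trans (∧-zeroʳ _) (≡.sym (trans (sym G v u) nonEdge))
      unchanged′ (no _)                     = ∧-identityʳ _

removeEdges : (G : Graph) → List (Fin (n G) × Fin (n G)) → Graph
removeEdges G []              = G
removeEdges G ((u , v) ∷ uvs) = removeEdges (removeEdge G u v) uvs

removeEdges-covering : ∀ G uvs → (∀ {i j} → adj G i j ≡ true → (i , j) ∈ uvs) →
                       removeEdges G uvs ≅ emptyGraph (n G)
removeEdges-covering G [] covers = ≗⇒≅ λ i j → ¬-not (λ edge → case covers edge of λ ())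
removeEdges-covering G ((u , v) ∷ uvs) covers = removeEdges-covering (removeEdge G u v) uvs covers′
  where
  covers′ : ∀ {i j} → adj (removeEdge G u v) i j ≡ true → (i , j) ∈ uvs
  covers′ edge with covers (removeEdge-⊆ G u v edge)
  ... | here refl = case trans (≡.sym edge) (removeEdge-removes G u v) of λ ()
  ... | there ij∈uvs = ij∈uvs

record CriticalEdge (Φ : Graph → Bool) (N : ℕ) : Set where
  field
    H        : Graph
    size     : n H ≡ N
    u v      : Fin (n H)
    edge     : adj H u v ≡ true
    critical : Φ H ≢ Φ (removeEdge H u v)

module _ {Φ : Graph → Bool} (Φ-iso : IsGraphProperty Φ) where

  criticalEdge-removeEdges : ∀ G uvs → Φ G ≢ Φ (removeEdges G uvs) → CriticalEdge Φ (n G)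
  criticalEdge-removeEdges G [] Φ≢ = ⊥-elim (Φ≢ refl)
  criticalEdge-removeEdges G ((u , v) ∷ uvs) Φ≢ with Φ G ≟ᵇ Φ (removeEdge G u v)
  ... | yes same   = criticalEdge-removeEdges (removeEdge G u v) uvs (Φ≢ ∘ trans same)
  ... | no changed = record
    { H = G ; size = refl ; u = u ; v = v ; critical = changed
    ; edge = ¬-not (λ nonEdge → changed (≡.sym (Φ-iso _ _ (removeEdge-nonEdge G u v nonEdge))))
    }

  criticalEdge-empty : ∀ G → Φ G ≢ Φ (emptyGraph (n G)) → CriticalEdge Φ (n G)
  criticalEdge-empty G Φ≢ = criticalEdge-removeEdges G allPairs
    (λ e → Φ≢ (trans e (Φ-iso _ _ (removeEdges-covering G allPairs
                 λ _ → ∈-cartesianProduct⁺ (∈-allFin _) (∈-allFin _)))))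
    where
    allPairs : List (Fin (n G) × Fin (n G))
    allPairs = cartesianProduct (allFin (n G)) (allFin (n G))

  criticalEdge : ∀ G₁ G₂ → n G₁ ≡ n G₂ → Φ G₁ ≢ Φ G₂ → CriticalEdge Φ (n G₁)
  criticalEdge G₁ G₂ n₁≡n₂ Φ≢ with Φ G₁ ≟ᵇ Φ (emptyGraph (n G₁))
  ... | no Φ₁≢ = criticalEdge-empty G₁ Φ₁≢
  ... | yes Φ₁≡ = subst (CriticalEdge Φ) (≡.sym n₁≡n₂) (criticalEdge-empty G₂ λ Φ₂≡ →
    Φ≢ (trans Φ₁≡ (trans (cong (Φ ∘ emptyGraph) n₁≡n₂) (≡.sym Φ₂≡))))

-- Implants

constBip : ℕ → ℕ → Bool → Bip
constBip a b e = record { a = a ; b = b ; E = λ _ _ → e }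

module _ (H : Graph) (u v : Fin (n H)) where

  private
    outside : Fin (n H) → Bool
    outside w = not ⌊ w ≟ u ⌋ ∧ not ⌊ w ≟ v ⌋

  rv-outside : ∀ r → rv H u v r ≢ u × rv H u v r ≢ v
  rv-outside r = Prod.map (toWitnessFalse {a? = w ≟ u}) (toWitnessFalse {a? = w ≟ v})
    (to (T-∧ {not ⌊ w ≟ u ⌋}) (proj₂ (∈-filter⁻ (T? ∘ outside) {xs = allFin (n H)} (∈-lookup r))))
    where w = rv H u v r

  rv-surjective : ∀ {w} → w ≢ u → w ≢ v → ∃ λ r → rv H u v r ≡ w
  rv-surjective {w} w≢u w≢v = Any.index w∈R , ≡.sym (lookup-index w∈R)
    where
    w∈R : w ∈ Rlist H u v
    w∈R = ∈-filter⁺ (T? ∘ outside) (∈-allFin w)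
            (from (T-∧ {not ⌊ w ≟ u ⌋})
                  (fromWitnessFalse {a? = w ≟ u} w≢u , fromWitnessFalse {a? = w ≟ v} w≢v))

  embed : ∀ G → Part H u v G → Fin (a G + (b G + rsize H u v))
  embed G (p₁ i) = i ↑ˡ (b G + rsize H u v)
  embed G (p₂ j) = a G ↑ʳ (j ↑ˡ rsize H u v)
  embed G (pR r) = a G ↑ʳ (b G ↑ʳ r)

  part-embed : ∀ G p → part H u v G (embed G p) ≡ p
  part-embed G (p₁ i) rewrite splitAt-↑ˡ (a G) i (b G + rsize H u v) = refl
  part-embed G (p₂ j) rewrite splitAt-↑ʳ (a G) (b G + rsize H u v) (j ↑ˡ rsize H u v)
                            | splitAt-↑ˡ (b G) j (rsize H u v) = refl
  part-embed G (pR r) rewrite splitAt-↑ʳ (a G) (b G + rsize H u v) (b G ↑ʳ r)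
                            | splitAt-↑ʳ (b G) (rsize H u v) r = refl

  module _ {k l : ℕ} {e : Bool} (i₀ : Fin k) (j₀ : Fin l)
           {A : Fin (n H) → Fin (n H) → Bool}
           {A-sym : ∀ i j → A i j ≡ A j i} {A-irrefl : ∀ i → A i i ≡ false}
           (A-uv : A u v ≡ e) (A-off-uv : ∀ {i} j → i ≢ u → i ≢ v → A i j ≡ adj H i j) where

    private
      G = constBip k l e

      A-R : ∀ r w → A (rv H u v r) w ≡ adj H (rv H u v r) w
      A-R r w = A-off-uv w (proj₁ (rv-outside r)) (proj₂ (rv-outside r))

    vertex : Part H u v G → Fin (n H)
    vertex (p₁ _) = u
    vertex (p₂ _) = v
    vertex (pR r) = rv H u v r

    adj-vertex : ∀ p q → A (vertex p) (vertex q) ≡ padj H u v G p q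
    adj-vertex (p₁ i) (p₁ j) = A-irrefl u
    adj-vertex (p₁ i) (p₂ j) = A-uv
    adj-vertex (p₁ i) (pR r) = trans (A-sym u (rv H u v r)) (A-R r u)
    adj-vertex (p₂ i) (p₁ j) = trans (A-sym v u) A-uv
    adj-vertex (p₂ i) (p₂ j) = A-irrefl v
    adj-vertex (p₂ i) (pR r) = trans (A-sym v (rv H u v r)) (A-R r v)
    adj-vertex (pR r) (p₁ j) = A-R r u
    adj-vertex (pR r) (p₂ j) = A-R r v
    adj-vertex (pR r) (pR s) = A-R r (rv H u v s)

    preimage : ∀ w → ∃ λ p → vertex p ≡ w
    preimage w with w ≟ u
    ... | yes refl = p₁ i₀ , refl
    ... | no w≢u with w ≟ v
    ...   | yes refl = p₂ j₀ , refl
    ...   | no w≢v   = Prod.map pR id (rv-surjective w≢u w≢v)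

    implant-constBip-blowup : Blowup (implant H u v G) (graph A A-sym A-irrefl)
    implant-constBip-blowup = record
      { collapse      = vertex ∘ part H u v G
      ; lift          = embed G ∘ proj₁ ∘ preimage
      ; collapse-adj  = λ x y → adj-vertex (part H u v G x) (part H u v G y)
      ; collapse-lift = λ w → trans (cong vertex (part-embed G (proj₁ (preimage w)))) (proj₂ (preimage w))
      }

lemma26 : (Φ : Graph → Bool) → IsGraphProperty Φ → TwinInvariant Φ → NotMeagre Φ →
    Σ Graph λ H → Σ (Fin (n H)) λ u → Σ (Fin (n H)) λ v →
      adj H u v ≡ true × (∀ k → 1 ≤ k → Ψ Φ H u v (Bkk k) ≢ Ψ Φ H u v (Ikk k))
lemma26 Φ Φ-iso Φ-twin notMeagre with notMeagre (0 ∷ 1 ∷ [])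
... | N , N∉01 , G₁ , G₂ , n₁≡N , n₂≡N , Φ≢ = H , u , v , edge , separates
  where
  open CriticalEdge (criticalEdge Φ-iso G₁ G₂ (trans n₁≡N (≡.sym n₂≡N)) Φ≢)

  ∉01⇒2≤ : ∀ {m} → m ∉ 0 ∷ 1 ∷ [] → 2 ≤ m
  ∉01⇒2≤ {0}           0∉ = ⊥-elim (0∉ (here refl))
  ∉01⇒2≤ {1}           1∉ = ⊥-elim (1∉ (there (here refl)))
  ∉01⇒2≤ {suc (suc _)} _  = s≤s (s≤s z≤n)

  2≤H : 2 ≤ n H
  2≤H = subst (2 ≤_) (≡.sym (trans size n₁≡N)) (∉01⇒2≤ N∉01)

  separates : ∀ k → 1 ≤ k → Ψ Φ H u v (Bkk k) ≢ Ψ Φ H u v (Ikk k)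
  separates (suc k) _ Ψ≡ = critical (begin
    Φ H                              ≡⟨ Φ-twin _ _ 2≤implant 2≤H (blowup⇒TwinEquivalent blowup-B) ⟨
    Φ (implant H u v (Bkk (suc k)))  ≡⟨ Ψ≡ ⟩
    Φ (implant H u v (Ikk (suc k)))  ≡⟨ Φ-twin _ _ 2≤implant 2≤H (blowup⇒TwinEquivalent blowup-I) ⟩
    Φ (removeEdge H u v)             ∎)
    where
    open ≡-Reasoning

    2≤implant : 2 ≤ suc k + (suc k + rsize H u v)
    2≤implant = s≤s (≤-trans (s≤s z≤n) (m≤n+m _ k))

    blowup-B : Blowup (implant H u v (Bkk (suc k))) H
    blowup-B = implant-constBip-blowup H u v zero zero edge (λ _ _ _ → refl)

    blowup-I : Blowup (implant H u v (Ikk (suc k))) (removeEdge H u v)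
    blowup-I = implant-constBip-blowup H u v zero zero (removeEdge-removes H u v) (λ _ → removeEdge-away H u v)
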